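{- Let $k\ge 1$ and $a_1,\ldots,a_k$ be positive integers, and let $G$ be a simple graph that is degree equivalent to the disjoint union of complete graphs $K_{a_1}\cup\cdots\cup K_{a_k}$. Then $\alpha(G)=k$ if and only if $G$ is isomorphic to $K_{a_1}\cup\cdots\cup K_{a_k}$.
   Context: All graphs are finite simple graphs. Two graphs are degree equivalent if they have the same multiset of vertex degrees. $\alpha(G)$ is the independence number of $G$ (size of a largest set of pairwise nonadjacent vertices). $K_{a_1}\cup\cdots\cup K_{a_k}$ is the vertex-disjoint union of complete graphs on $a_1,\ldots,a_k$ vertices. -}

module Defs where

open import Data.Nat using (ℕ; zero; suc; _+_; _≤_)
open import Data.Bool using (Bool; true; false; _∧_; not)
open import Data.Fin using (Fin; zero; suc; _≟_)
open import Data.Fin.Subset using (Subset; _∈_; ∣_∣)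
open import Data.List using (List; []; _∷_; map; length; filter)
open import Data.Nat.ListAction using (sum)
open import Data.List.Relation.Binary.Permutation.Propositional using (_↭_)
open import Data.Vec using (allFin) renaming (toList to vtoList)
open import Data.Nat using (_≡ᵇ_)
open import Data.Product using (Σ; _×_; _,_)
open import Function.Bundles using (_⤖_; Bijection)
open import Relation.Binary.PropositionalEquality using (_≡_; refl; cong; cong₂; trans) renaming (sym to ≡-sym)
open import Data.Bool.Properties using (∧-zeroʳ)
open import Data.Empty using (⊥-elim)
open import Relation.Nullary using (¬_; yes; no)
open import Relation.Nullary.Decidable using (⌊_⌋)

record Graph (n : ℕ) : Set where
  field
    adj   : Fin n → Fin n → Bool
    sym   : ∀ u v → adj u v ≡ adj v u
    irrefl : ∀ v → adj v v ≡ false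
open Graph public

vertices : (n : ℕ) → List (Fin n)
vertices n = vtoList (allFin n)

degree : ∀ {n} → Graph n → Fin n → ℕ
degree {n} G v = length (filter (λ u → adj G v u Data.Bool.≟ true) (vertices n))

degreeList : ∀ {n} → Graph n → List ℕ
degreeList {n} G = map (degree G) (vertices n)

DegreeEquivalent : ∀ {m n} → Graph m → Graph n → Set
DegreeEquivalent G H = degreeList G ↭ degreeList H

Independent : ∀ {n} → Graph n → Subset n → Set
Independent G S = ∀ u v → u ∈ S → v ∈ S → adj G u v ≡ false

IndependenceNumber : ∀ {n} → Graph n → ℕ → Set
IndependenceNumber {n} G k =
  Σ (Subset n) (λ S → Independent G S × ∣ S ∣ ≡ k)
  × (∀ (S : Subset n) → Independent G S → ∣ S ∣ ≤ k)

Isomorphic : ∀ {m n} → Graph m → Graph n → Set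
Isomorphic {m} {n} G H =
  Σ (Fin m ⤖ Fin n) (λ f → ∀ u v → adj H (Bijection.to f u) (Bijection.to f v) ≡ adj G u v)

-- block index of a vertex of K_{a_1} ∪ ... ∪ K_{a_k}, vertices numbered
-- consecutively block by block: first a_1 vertices in block 0, etc.
block : (as : List ℕ) → Fin (sum as) → ℕ
block [] ()
block (zero ∷ as) v = suc (block as v)
block (suc a ∷ as) zero = zero
block (suc a ∷ as) (suc v) = block (a ∷ as) v

private
  eqᵇ : ∀ {n} → Fin n → Fin n → Bool
  eqᵇ u v = ⌊ u ≟ v ⌋

unionAdj : (as : List ℕ) → Fin (sum as) → Fin (sum as) → Bool
unionAdj as u v = (block as u ≡ᵇ block as v) ∧ not (eqᵇ u v)

private
  ≡ᵇ-sym : ∀ x y → (x ≡ᵇ y) ≡ (y ≡ᵇ x)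
  ≡ᵇ-sym zero zero = refl
  ≡ᵇ-sym zero (suc y) = refl
  ≡ᵇ-sym (suc x) zero = refl
  ≡ᵇ-sym (suc x) (suc y) = ≡ᵇ-sym x y

  eqᵇ-sym : ∀ {n} (u v : Fin n) → eqᵇ u v ≡ eqᵇ v u
  eqᵇ-sym u v with u ≟ v | v ≟ u
  ... | yes _ | yes _ = refl
  ... | no _ | no _ = refl
  ... | yes p | no ¬q = ⊥-elim (¬q (≡-sym p))
  ... | no ¬p | yes q = ⊥-elim (¬p (≡-sym q))

  eqᵇ-refl : ∀ {n} (u : Fin n) → eqᵇ u u ≡ true
  eqᵇ-refl u with u ≟ u
  ... | yes _ = refl
  ... | no ¬p = ⊥-elim (¬p refl)

⋃K : (as : List ℕ) → Graph (sum as)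
⋃K as = record
  { adj = unionAdj as
  ; sym = λ u v → cong₂ (λ x y → x ∧ not y) (≡ᵇ-sym (block as u) (block as v)) (eqᵇ-sym u v)
  ; irrefl = λ u → trans (cong (λ y → (block as u ≡ᵇ block as u) ∧ not y) (eqᵇ-refl u)) (∧-zeroʳ _)
  }

-- Scale the Caro–Wei weights 1/(d+1) by m! so that they stay in ℕ. Repeatedly picking a
-- vertex v of minimum degree and deleting its closed neighbourhood N[v] produces an independent
-- set I with Σ_u m!/(deg u + 1) ≤ m! · |I|; the inequality is strict unless, at every step, no
-- edge leaves N[v] and N[v] is a clique, i.e. unless G is a disjoint union of cliques. When G has
-- the degrees of K_{a_1} ∪ ⋯ ∪ K_{a_k} the weight sum is exactly k · m!, so α(G) ≥ k, and
-- α(G) = k forces G to be a cluster graph. A cluster graph with these degrees is isomorphic to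
-- K_{a_1} ∪ ⋯ ∪ K_{a_k}: peel off the clique around a vertex of degree a_1 - 1 and recurse.
-- Conversely, an independent set of K_{a_1} ∪ ⋯ ∪ K_{a_k} meets every block at most once.

module Submission where

open import Algebra.Properties.CommutativeSemigroup using (x∙yz≈y∙xz)
open import Data.Bool using (Bool; true; false; _∧_; _∨_; not; if_then_else_)
import Data.Bool as Bool
open import Data.Bool.Properties
  using (T-≡; ∧-identityʳ; ∨-zeroʳ; ∨-conicalˡ; ∨-conicalʳ; not-injective)
open import Data.Empty using (⊥; ⊥-elim)
open import Data.Fin using (Fin; zero; suc)
import Data.Fin as Fin
open import Data.Fin.Subset using (Subset; ∣_∣) renaming (_∈_ to _∈ₛ_)
open import Data.List
  using (List; []; _∷_; _++_; map; length; filter; filterᵇ; replicate; take; allFin; tabulate; upTo)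
open import Data.List.Extrema.Nat using (argmin; argmin-sel; f[argmin]≤f[xs])
import Data.List.Membership.DecPropositional as DecMembership
open import Data.List.Membership.Propositional using (_∈_; _∉_; find; lose)
open import Data.List.Membership.Propositional.Properties
  using (∈-filter⁺; ∈-filter⁻; ∈-allFin; ∈-map⁻; ∈-upTo⁺)
open import Data.List.Properties
  using (length-filter; filter-++; length-++; map-∘; map-++; map-cong; map-replicate; map-tabulate;
         length-tabulate; length-map; length-take; length-upTo)
open import Data.List.Relation.Binary.Permutation.Propositional using (_↭_)
open import Data.List.Relation.Binary.Permutation.Propositional.Properties
  using (filter-↭; ↭-length) renaming (map⁺ to ↭-map⁺)
open import Data.List.Relation.Unary.All using (All; []; _∷_)
import Data.List.Relation.Unary.All as All
import Data.List.Relation.Unary.All.Properties as AllProps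
open import Data.List.Relation.Unary.Any using (here; there; any?)
open import Data.List.Relation.Unary.Unique.Propositional using (Unique; []; _∷_)
open import Data.List.Relation.Unary.Unique.Propositional.Properties using (filter⁺; take⁺; allFin⁺)
open import Data.Nat using (ℕ; zero; suc; pred; _+_; _*_; _⊓_; _≤_; _<_; z≤n; s≤s; _≡ᵇ_; _!; _/_; _<?_;
                            NonZero; ≢-nonZero; ≢-nonZero⁻¹)
open import Data.Nat.Divisibility using (∣-trans; m∣m*n; m≤n⇒m!∣n!)
open import Data.Nat.DivMod using (m*[n/m]≡n; m/n*n≤m; /-monoʳ-≤)
open import Data.Nat.ListAction using (sum)
open import Data.Nat.ListAction.Properties using (sum-++; sum-↭)
open import Data.Nat.Properties
open import Data.Product using (Σ; ∃-syntax; _×_; _,_; proj₁; proj₂; map₂)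
open import Data.Sum using (_⊎_; inj₁; inj₂; [_,_]′)
import Data.Vec as Vec
open import Data.Vec.Properties using (lookup∘tabulate; []=⇒lookup; lookup⇒[]=)
open import Function using (_∘_)
open import Function.Bundles using (_⇔_; mk⇔; mk⤖; Bijection; Equivalence)
open import Relation.Binary.Definitions using (DecidableEquality)
open import Relation.Binary.PropositionalEquality
  using (_≡_; _≢_; refl; sym; trans; cong; cong₂; subst; module ≡-Reasoning)
open import Relation.Nullary using (yes; no; does; contradiction)
open import Relation.Nullary.Decidable using (⌊_⌋; T?; dec-true; dec-false; toWitness; fromWitness)

open import Defs renaming (sym to adj-sym)

module _ {A : Set} where

  count : (A → Bool) → List A → ℕ
  count p xs = length (filterᵇ p xs)

  ∈-filterᵇ⁺ : ∀ (p : A → Bool) {x xs} → x ∈ xs → p x ≡ true → x ∈ filterᵇ p xs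
  ∈-filterᵇ⁺ p x∈xs px = ∈-filter⁺ (T? ∘ p) x∈xs (Equivalence.from T-≡ px)

  ∈-filterᵇ⁻ : ∀ (p : A → Bool) {x} xs → x ∈ filterᵇ p xs → x ∈ xs × p x ≡ true
  ∈-filterᵇ⁻ p xs x∈ = map₂ (Equivalence.to T-≡) (∈-filter⁻ (T? ∘ p) x∈)

  count≤length : ∀ p xs → count p xs ≤ length xs
  count≤length p = length-filter (T? ∘ p)

  count-++ : ∀ p xs ys → count p (xs ++ ys) ≡ count p xs + count p ys
  count-++ p xs ys = trans (cong length (filter-++ (T? ∘ p) xs ys)) (length-++ (filterᵇ p xs))

  count-↭ : ∀ p {xs ys} → xs ↭ ys → count p xs ≡ count p ys
  count-↭ p xs↭ys = ↭-length (filter-↭ (T? ∘ p) xs↭ys)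

  count-partition : ∀ q p xs → count q xs ≡ count q (filterᵇ p xs) + count q (filterᵇ (not ∘ p) xs)
  count-partition q p [] = refl
  count-partition q p (x ∷ xs) with p x
  ... | true with q x
  ...   | true  = cong suc (count-partition q p xs)
  ...   | false = count-partition q p xs
  count-partition q p (x ∷ xs) | false with q x
  ...   | true  = trans (cong suc (count-partition q p xs)) (sym (+-suc _ _))
  ...   | false = count-partition q p xs

  count-filter≤ : ∀ q p xs → count q (filterᵇ p xs) ≤ count q xs
  count-filter≤ q p xs = ≤-trans (m≤m+n _ _) (≤-reflexive (sym (count-partition q p xs)))

  count-cong : ∀ {p q} xs → (∀ {x} → x ∈ xs → p x ≡ q x) → count p xs ≡ count q xs
  count-cong [] eq = refl
  count-cong {p} {q} (x ∷ xs) eq with p x | q x | eq (here refl)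
  ... | true  | true  | refl = cong suc (count-cong xs (eq ∘ there))
  ... | false | false | refl = count-cong xs (eq ∘ there)

  count-none : ∀ {p} xs → (∀ {x} → x ∈ xs → p x ≡ false) → count p xs ≡ 0
  count-none [] _ = refl
  count-none {p} (x ∷ xs) none with p x | none (here refl)
  ... | false | refl = count-none xs (none ∘ there)

  count-all : ∀ {p} xs → (∀ {x} → x ∈ xs → p x ≡ true) → count p xs ≡ length xs
  count-all [] _ = refl
  count-all {p} (x ∷ xs) all with p x | all (here refl)
  ... | true | refl = cong suc (count-all xs (all ∘ there))

  count≡0⇒false : ∀ {p x} xs → count p xs ≡ 0 → x ∈ xs → p x ≡ false
  count≡0⇒false {p} (y ∷ xs) c≡0 x∈ with p y in py
  count≡0⇒false (y ∷ xs) c≡0 (here refl) | false = py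
  count≡0⇒false (y ∷ xs) c≡0 (there x∈) | false = count≡0⇒false xs c≡0 x∈

  count≥length⇒true : ∀ {p x} xs → length xs ≤ count p xs → x ∈ xs → p x ≡ true
  count≥length⇒true {p} (y ∷ xs) full x∈ with p y in py
  count≥length⇒true (y ∷ xs) full (here refl) | true = py
  count≥length⇒true (y ∷ xs) full (there x∈) | true = count≥length⇒true xs (≤-pred full) x∈
  ... | false = contradiction full (<⇒≱ (s≤s (count≤length _ xs)))

  count<length : ∀ {p x} xs → x ∈ xs → p x ≡ false → count p xs < length xs
  count<length xs x∈ px =
    ≰⇒> λ full → contradiction (trans (sym (count≥length⇒true xs full x∈)) px) λ ()

  ∈⇒count>0 : ∀ {p x} xs → x ∈ xs → p x ≡ true → 0 < count p xs
  ∈⇒count>0 {p} (y ∷ xs) x∈ px with p y in py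
  ... | true = s≤s z≤n
  ∈⇒count>0 (y ∷ xs) (here refl) px | false = contradiction (trans (sym py) px) λ ()
  ∈⇒count>0 (y ∷ xs) (there x∈) px | false = ∈⇒count>0 xs x∈ px

  count-const : ∀ b xs → count (λ _ → b) xs ≡ (if b then length xs else 0)
  count-const true  []       = refl
  count-const false []       = refl
  count-const true  (x ∷ xs) = cong suc (count-const true xs)
  count-const false (x ∷ xs) = count-const false xs

  count-replicate : ∀ p n x → count p (replicate n x) ≡ (if p x then n else 0)
  count-replicate p zero x with p x
  ... | true  = refl
  ... | false = refl
  count-replicate p (suc n) x with p x in px
  ... | true  = cong suc (trans (count-replicate p n x) (cong (λ b → if b then n else 0) px))
  ... | false = trans (count-replicate p n x) (cong (λ b → if b then n else 0) px)

  count>0⇒∃ : ∀ p xs → 0 < count p xs → ∃[ x ] x ∈ xs × p x ≡ true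
  count>0⇒∃ p (x ∷ xs) pos with p x in px
  ... | true  = x , here refl , px
  ... | false = let y , y∈ , py = count>0⇒∃ p xs pos in y , there y∈ , py

  count-∨ : ∀ {p q} xs → (∀ {x} → p x ≡ true → q x ≡ false) →
            count (λ x → p x ∨ q x) xs ≡ count p xs + count q xs
  count-∨ [] _ = refl
  count-∨ {p} {q} (x ∷ xs) disj with p x in px | q x in qx
  ... | true  | true  = contradiction (trans (sym qx) (disj px)) λ ()
  ... | true  | false = cong suc (count-∨ xs disj)
  ... | false | true  = trans (cong suc (count-∨ xs disj)) (sym (+-suc _ _))
  ... | false | false = count-∨ xs disj

  sum-map-partition : ∀ (f : A → ℕ) p xs →
    sum (map f xs) ≡ sum (map f (filterᵇ p xs)) + sum (map f (filterᵇ (not ∘ p) xs))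
  sum-map-partition f p [] = refl
  sum-map-partition f p (x ∷ xs) with p x
  ... | true  = trans (cong (f x +_) (sum-map-partition f p xs)) (sym (+-assoc (f x) _ _))
  ... | false = trans (cong (f x +_) (sum-map-partition f p xs))
      (x∙yz≈y∙xz +-commutativeSemigroup (f x) (sum (map f (filterᵇ p xs)))
                                              (sum (map f (filterᵇ (not ∘ p) xs))))

  sum-map-≤-* : ∀ (f : A → ℕ) c xs → (∀ {x} → x ∈ xs → f x ≤ c) → sum (map f xs) ≤ length xs * c
  sum-map-≤-* f c [] _ = z≤n
  sum-map-≤-* f c (x ∷ xs) f≤c = +-mono-≤ (f≤c (here refl)) (sum-map-≤-* f c xs (f≤c ∘ there))

  sum-map-mono-≤ : ∀ {f g : A → ℕ} xs → (∀ x → f x ≤ g x) → sum (map f xs) ≤ sum (map g xs)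
  sum-map-mono-≤ [] _ = z≤n
  sum-map-mono-≤ (x ∷ xs) f≤g = +-mono-≤ (f≤g x) (sum-map-mono-≤ xs f≤g)

  sum-map-mono-< : ∀ {f g : A → ℕ} {y} xs → (∀ x → f x ≤ g x) → y ∈ xs → f y < g y →
                   sum (map f xs) < sum (map g xs)
  sum-map-mono-< (x ∷ xs) f≤g (here refl) fy<gy = +-mono-<-≤ fy<gy (sum-map-mono-≤ xs f≤g)
  sum-map-mono-< (x ∷ xs) f≤g (there y∈) fy<gy = +-mono-≤-< (f≤g x) (sum-map-mono-< xs f≤g y∈ fy<gy)

count-map : ∀ {A B : Set} (p : B → Bool) (f : A → B) xs → count p (map f xs) ≡ count (p ∘ f) xs
count-map p f [] = refl
count-map p f (x ∷ xs) with p (f x)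
... | true  = cong suc (count-map p f xs)
... | false = count-map p f xs

module WithDecEq {A : Set} (_≟_ : DecidableEquality A) where

  _≟ᵇ_ : A → A → Bool
  x ≟ᵇ y = does (x ≟ y)

  ≟ᵇ-refl : ∀ x → x ≟ᵇ x ≡ true
  ≟ᵇ-refl x = dec-true (x ≟ x) refl

  ≟ᵇ-≢ : ∀ {x y} → x ≢ y → x ≟ᵇ y ≡ false
  ≟ᵇ-≢ {x} {y} = dec-false (x ≟ y)

  ≟ᵇ⇒≡ : ∀ {x y} → x ≟ᵇ y ≡ true → x ≡ y
  ≟ᵇ⇒≡ {x} {y} eq with x ≟ y
  ... | yes x≡y = x≡y

  count-≟ᵇ : ∀ {v} xs → Unique xs → v ∈ xs → count (_≟ᵇ v) xs ≡ 1
  count-≟ᵇ (x ∷ xs) (x∉ ∷ _) (here refl) rewrite ≟ᵇ-refl x =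
    cong suc (count-none xs λ y∈ → ≟ᵇ-≢ λ { refl → All.lookup x∉ y∈ refl })
  count-≟ᵇ {v} (x ∷ xs) (x∉ ∷ u) (there v∈) rewrite ≟ᵇ-≢ {x} {v} (All.lookup x∉ v∈) =
    count-≟ᵇ xs u v∈

  count-≟ᵇ-∨ : ∀ {v} {q : A → Bool} xs → q v ≡ false → Unique xs → v ∈ xs →
               count (λ u → (u ≟ᵇ v) ∨ q u) xs ≡ suc (count q xs)
  count-≟ᵇ-∨ {v} {q} xs qv u v∈ =
    trans (count-∨ xs λ {x} x≟v → subst (λ y → q y ≡ false) (sym (≟ᵇ⇒≡ x≟v)) qv)
          (cong (_+ count q xs) (count-≟ᵇ xs u v∈))

  unique-⊆⇒length≤ : ∀ {xs ys : List A} → Unique xs → (∀ {x} → x ∈ xs → x ∈ ys) →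
                     length xs ≤ length ys
  unique-⊆⇒length≤ [] _ = z≤n
  unique-⊆⇒length≤ {x ∷ xs} {ys} (x∉ ∷ u) ⊆ys = begin-strict
      length xs                 ≤⟨ unique-⊆⇒length≤ u xs⊆ys∖x ⟩
      count (not ∘ (_≟ᵇ x)) ys  <⟨ count<length ys (⊆ys (here refl)) (cong not (≟ᵇ-refl x)) ⟩
      length ys                 ∎
    where
      open ≤-Reasoning
      xs⊆ys∖x : ∀ {y} → y ∈ xs → y ∈ filterᵇ (not ∘ (_≟ᵇ x)) ys
      xs⊆ys∖x y∈ = ∈-filterᵇ⁺ (not ∘ (_≟ᵇ x)) (⊆ys (there y∈))
                     (cong not (≟ᵇ-≢ λ { refl → All.lookup x∉ y∈ refl }))

  count-⊆ : ∀ p {xs ys} → Unique xs → (∀ {x} → x ∈ xs → p x ≡ true → x ∈ ys) →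
            count p xs ≤ count p ys
  count-⊆ p {xs} uniq ⊆ys = unique-⊆⇒length≤ (filter⁺ (T? ∘ p) uniq) λ x∈ →
    let x∈xs , px = ∈-filterᵇ⁻ p xs x∈ in ∈-filterᵇ⁺ p (⊆ys x∈xs px) px

map-unique : ∀ {A B : Set} (f : A → B) {xs} → Unique xs →
             (∀ {x y} → x ∈ xs → y ∈ xs → f x ≡ f y → x ≡ y) → Unique (map f xs)
map-unique f [] _ = []
map-unique f (x∉ ∷ uniq) inj =
  AllProps.map⁺ (All.tabulate λ y∈ fx≡fy → All.lookup x∉ y∈ (inj (here refl) (there y∈) fx≡fy))
  ∷ map-unique f uniq (λ x∈ y∈ → inj (there x∈) (there y∈))

∈-take⁻ : ∀ {A : Set} n {x : A} xs → x ∈ take n xs → x ∈ xs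
∈-take⁻ (suc n) (y ∷ xs) (here refl) = here refl
∈-take⁻ (suc n) (y ∷ xs) (there x∈) = there (∈-take⁻ n xs x∈)

toList-tabulate : ∀ {A : Set} {n} (f : Fin n → A) → Vec.toList (Vec.tabulate f) ≡ tabulate f
toList-tabulate {n = zero} f = refl
toList-tabulate {n = suc n} f = cong (f zero ∷_) (toList-tabulate (f ∘ suc))

vertices≡allFin : ∀ n → vertices n ≡ allFin n
vertices≡allFin n = toList-tabulate (λ i → i)

∈-vertices : ∀ {n} (u : Fin n) → u ∈ vertices n
∈-vertices {n} u = subst (u ∈_) (sym (vertices≡allFin n)) (∈-allFin u)

vertices-unique : ∀ n → Unique (vertices n)
vertices-unique n = subst Unique (sym (vertices≡allFin n)) (allFin⁺ n)

length-vertices : ∀ n → length (vertices n) ≡ n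
length-vertices n = trans (cong length (vertices≡allFin n)) (length-tabulate (λ i → i))

vertices-suc : ∀ n → vertices (suc n) ≡ zero ∷ map suc (vertices n)
vertices-suc n = begin
  vertices (suc n)               ≡⟨ vertices≡allFin (suc n) ⟩
  zero ∷ tabulate suc            ≡⟨ cong (zero ∷_) (sym (map-tabulate (λ i → i) suc)) ⟩
  zero ∷ map suc (allFin n)      ≡⟨ cong (λ vs → zero ∷ map suc vs) (sym (vertices≡allFin n)) ⟩
  zero ∷ map suc (vertices n)    ∎
  where open ≡-Reasoning

filter-≟true : ∀ {A : Set} (p : A → Bool) xs → filter (λ x → p x Bool.≟ true) xs ≡ filterᵇ p xs
filter-≟true p [] = refl
filter-≟true p (x ∷ xs) with p x
... | true  = cong (x ∷_) (filter-≟true p xs)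
... | false = filter-≟true p xs

degree≡count : ∀ {n} (G : Graph n) u → degree G u ≡ count (adj G u) (vertices n)
degree≡count {n} G u = cong length (filter-≟true (adj G u) (vertices n))

length-degreeList : ∀ {n} (G : Graph n) → length (degreeList G) ≡ n
length-degreeList {n} G = trans (length-map (degree G) (vertices n)) (length-vertices n)

∣∣≡count : ∀ {n} (S : Subset n) → ∣ S ∣ ≡ count (Vec.lookup S) (vertices n)
∣∣≡count {zero} Vec.[] = refl
∣∣≡count {suc n} (b Vec.∷ S) =
  trans (by-head b) (cong (count (Vec.lookup (b Vec.∷ S))) (sym (vertices-suc n)))
  where
    rest : ∀ b → count (Vec.lookup (b Vec.∷ S)) (map suc (vertices n)) ≡ ∣ S ∣
    rest b = trans (count-map (Vec.lookup (b Vec.∷ S)) suc (vertices n)) (sym (∣∣≡count S))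
    by-head : ∀ b → ∣ b Vec.∷ S ∣ ≡ count (Vec.lookup (b Vec.∷ S)) (zero ∷ map suc (vertices n))
    by-head true  = cong suc (sym (rest true))
    by-head false = sym (rest false)

module _ {n : ℕ} where
  open DecMembership (Fin._≟_ {n}) using (_∈?_)

  elements : Subset n → List (Fin n)
  elements S = filterᵇ (Vec.lookup S) (vertices n)

  elements-unique : ∀ S → Unique (elements S)
  elements-unique S = filter⁺ (T? ∘ Vec.lookup S) (vertices-unique n)

  length-elements : ∀ S → length (elements S) ≡ ∣ S ∣
  length-elements S = sym (∣∣≡count S)

  ∈elements⁻ : ∀ S {u} → u ∈ elements S → u ∈ₛ S
  ∈elements⁻ S {u} u∈ = lookup⇒[]= u S (proj₂ (∈-filterᵇ⁻ (Vec.lookup S) (vertices n) u∈))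

  fromList : List (Fin n) → Subset n
  fromList I = Vec.tabulate (λ u → ⌊ u ∈? I ⌋)

  lookup-fromList : ∀ I u → Vec.lookup (fromList I) u ≡ ⌊ u ∈? I ⌋
  lookup-fromList I = lookup∘tabulate (λ u → ⌊ u ∈? I ⌋)

  ∈fromList⁻ : ∀ I {u} → u ∈ₛ fromList I → u ∈ I
  ∈fromList⁻ I {u} u∈ =
    toWitness (Equivalence.from T-≡ (trans (sym (lookup-fromList I u)) ([]=⇒lookup u∈)))

  ∣fromList∣ : ∀ {I} → Unique I → ∣ fromList I ∣ ≡ length I
  ∣fromList∣ {I} uniq = begin
    ∣ fromList I ∣                                ≡⟨ ∣∣≡count (fromList I) ⟩
    count (Vec.lookup (fromList I)) (vertices n)  ≡⟨ count-cong (vertices n) (λ {u} _ → lookup-fromList I u) ⟩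
    count inI (vertices n)                        ≡⟨ ≤-antisym filter⊆I I⊆filter ⟩
    length I                                      ∎
    where
      open ≡-Reasoning
      open WithDecEq (Fin._≟_ {n}) using (unique-⊆⇒length≤)
      inI : Fin n → Bool
      inI u = ⌊ u ∈? I ⌋
      filter⊆I : count inI (vertices n) ≤ length I
      filter⊆I = unique-⊆⇒length≤ (filter⁺ (T? ∘ inI) (vertices-unique n))
        (λ u∈ → toWitness (Equivalence.from T-≡ (proj₂ (∈-filterᵇ⁻ inI (vertices n) u∈))))
      I⊆filter : length I ≤ count inI (vertices n)
      I⊆filter = unique-⊆⇒length≤ uniq
        (λ {u} u∈ → ∈-filterᵇ⁺ inI (∈-vertices u) (Equivalence.to T-≡ (fromWitness u∈)))

-- The disjoint union of cliques

blockList : List ℕ → List ℕ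
blockList [] = []
blockList (a ∷ as) = replicate a 0 ++ map suc (blockList as)

cliqueDegrees : List ℕ → List ℕ
cliqueDegrees [] = []
cliqueDegrees (a ∷ as) = replicate a (pred a) ++ cliqueDegrees as

map-block : ∀ as → map (block as) (vertices (sum as)) ≡ blockList as
map-block-∷ : ∀ a as → map (block (a ∷ as)) (vertices (a + sum as)) ≡
                       replicate a 0 ++ map suc (blockList as)

map-block [] = refl
map-block (a ∷ as) = map-block-∷ a as

map-block-∷ zero as = trans (map-∘ (vertices (sum as))) (cong (map suc) (map-block as))
map-block-∷ (suc a) as = begin
  map (block (suc a ∷ as)) (vertices (suc (a + sum as)))
    ≡⟨ cong (map (block (suc a ∷ as))) (vertices-suc (a + sum as)) ⟩
  0 ∷ map (block (suc a ∷ as)) (map suc (vertices (a + sum as)))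
    ≡⟨ cong (0 ∷_) (sym (map-∘ (vertices (a + sum as)))) ⟩
  0 ∷ map (block (a ∷ as)) (vertices (a + sum as))
    ≡⟨ cong (0 ∷_) (map-block-∷ a as) ⟩
  0 ∷ replicate a 0 ++ map suc (blockList as)
    ∎
  where open ≡-Reasoning

≡ᵇ-refl : ∀ n → (n ≡ᵇ n) ≡ true
≡ᵇ-refl n = dec-true (n ≟ n) refl

count-blockList-0 : ∀ a bs → count (0 ≡ᵇ_) (replicate a 0 ++ map suc bs) ≡ a
count-blockList-0 zero [] = refl
count-blockList-0 zero (b ∷ bs) = count-blockList-0 zero bs
count-blockList-0 (suc a) bs = cong suc (count-blockList-0 a bs)

count-blockList-suc : ∀ a b bs → count (suc b ≡ᵇ_) (replicate a 0 ++ map suc bs) ≡ count (b ≡ᵇ_) bs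
count-blockList-suc zero b bs = count-map (suc b ≡ᵇ_) suc bs
count-blockList-suc (suc a) b bs = count-blockList-suc a b bs

blockSize : List ℕ → ℕ → ℕ
blockSize as b = count (b ≡ᵇ_) (blockList as)

map-blockSize : ∀ as → map (pred ∘ blockSize as) (blockList as) ≡ cliqueDegrees as
map-blockSize [] = refl
map-blockSize (a ∷ as) = begin
  map g (replicate a 0 ++ map suc (blockList as))
    ≡⟨ map-++ g (replicate a 0) (map suc (blockList as)) ⟩
  map g (replicate a 0) ++ map g (map suc (blockList as))
    ≡⟨ cong₂ _++_ (map-replicate g a 0) (sym (map-∘ (blockList as))) ⟩
  replicate a (g 0) ++ map (g ∘ suc) (blockList as)
    ≡⟨ cong₂ (λ x ys → replicate a (pred x) ++ ys) (count-blockList-0 a (blockList as))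
             (map-cong (λ b → cong pred (count-blockList-suc a b (blockList as))) (blockList as)) ⟩
  replicate a (pred a) ++ map (pred ∘ blockSize as) (blockList as)
    ≡⟨ cong (replicate a (pred a) ++_) (map-blockSize as) ⟩
  cliqueDegrees (a ∷ as)
    ∎
  where
    open ≡-Reasoning
    g = pred ∘ blockSize (a ∷ as)

module _ (as : List ℕ) where
  open WithDecEq (Fin._≟_ {sum as})

  ≟ᵇ-∨-unionAdj : ∀ v u → ((u ≟ᵇ v) ∨ unionAdj as v u) ≡ (block as v ≡ᵇ block as u)
  ≟ᵇ-∨-unionAdj v u with u Fin.≟ v | v Fin.≟ u
  ... | yes refl | _       = sym (≡ᵇ-refl (block as u))
  ... | no _     | no _    = ∧-identityʳ _
  ... | no u≢v   | yes v≡u = contradiction (sym v≡u) u≢v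

  suc-degree-⋃K : ∀ v → suc (degree (⋃K as) v) ≡ blockSize as (block as v)
  suc-degree-⋃K v = begin
    suc (degree (⋃K as) v)
      ≡⟨ cong suc (degree≡count (⋃K as) v) ⟩
    suc (count (unionAdj as v) V)
      ≡⟨ count-≟ᵇ-∨ V (irrefl (⋃K as) v) (vertices-unique _) (∈-vertices v) ⟨
    count (λ u → (u ≟ᵇ v) ∨ unionAdj as v u) V
      ≡⟨ count-cong V (λ {u} _ → ≟ᵇ-∨-unionAdj v u) ⟩
    count ((block as v ≡ᵇ_) ∘ block as) V
      ≡⟨ count-map (block as v ≡ᵇ_) (block as) V ⟨
    count (block as v ≡ᵇ_) (map (block as) V)
      ≡⟨ cong (count (block as v ≡ᵇ_)) (map-block as) ⟩
    blockSize as (block as v)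
      ∎
    where
      open ≡-Reasoning
      V = vertices (sum as)

  degreeList-⋃K : degreeList (⋃K as) ≡ cliqueDegrees as
  degreeList-⋃K = begin
    map (degree (⋃K as)) V                      ≡⟨ map-cong (λ v → cong pred (suc-degree-⋃K v)) V ⟩
    map (pred ∘ blockSize as ∘ block as) V      ≡⟨ map-∘ V ⟩
    map (pred ∘ blockSize as) (map (block as) V) ≡⟨ cong (map _) (map-block as) ⟩
    map (pred ∘ blockSize as) (blockList as)    ≡⟨ map-blockSize as ⟩
    cliqueDegrees as                            ∎
    where
      open ≡-Reasoning
      V = vertices (sum as)

block< : ∀ as (v : Fin (sum as)) → block as v < length as
block< (zero ∷ as)  v       = s≤s (block< as v)
block< (suc a ∷ as) zero    = s≤s z≤n
block< (suc a ∷ as) (suc v) = block< (a ∷ as) v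

independent-⋃K-length≤ : ∀ as {J} → Unique J → (∀ {i j} → i ∈ J → j ∈ J → unionAdj as i j ≡ false) →
                         length J ≤ length as
independent-⋃K-length≤ as {J} uniq indep = begin
  length J                    ≡⟨ length-map (block as) J ⟨
  length (map (block as) J)   ≤⟨ unique-⊆⇒length≤ (map-unique (block as) uniq block-injective) ⊆upTo ⟩
  length (upTo (length as))   ≡⟨ length-upTo (length as) ⟩
  length as                   ∎
  where
    open ≤-Reasoning
    open WithDecEq Data.Nat._≟_ using (unique-⊆⇒length≤)
    block-injective : ∀ {i j} → i ∈ J → j ∈ J → block as i ≡ block as j → i ≡ j
    block-injective {i} {j} i∈ j∈ same with i Fin.≟ j | indep i∈ j∈
    ... | yes i≡j | _      = i≡j
    ... | no _    | nonadj = contradiction (trans (sym same-block) (trans (sym (∧-identityʳ _)) nonadj)) λ ()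
      where
        same-block : (block as i ≡ᵇ block as j) ≡ true
        same-block = trans (cong (_≡ᵇ block as j) same) (≡ᵇ-refl (block as j))
    ⊆upTo : ∀ {b} → b ∈ map (block as) J → b ∈ upTo (length as)
    ⊆upTo b∈ with ∈-map⁻ (block as) b∈
    ... | i , _ , refl = ∈-upTo⁺ (block< as i)

-- Caro–Wei weights

sum-replicate : ∀ n x → sum (replicate n x) ≡ n * x
sum-replicate zero x = refl
sum-replicate (suc n) x = cong (x +_) (sum-replicate n x)

module Weights (n : ℕ) where

  -- An integer stand-in for n!/(d+1); the division is exact only when d < n.
  weight : ℕ → ℕ
  weight d = n ! / suc d

  weight-antitone : ∀ {d d'} → d ≤ d' → weight d' ≤ weight d
  weight-antitone d≤d' = /-monoʳ-≤ (n !) (s≤s d≤d')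

  suc*weight≤! : ∀ d → suc d * weight d ≤ n !
  suc*weight≤! d = ≤-trans (≤-reflexive (*-comm (suc d) (weight d))) (m/n*n≤m (n !) (suc d))

  suc*weight≡! : ∀ {d} → suc d ≤ n → suc d * weight d ≡ n !
  suc*weight≡! {d} d<n = m*[n/m]≡n (∣-trans (m∣m*n (d !)) (m≤n⇒m!∣n! d<n))

  weight-strict : ∀ {d d'} → d < d' → suc d' ≤ n → weight d' < weight d
  weight-strict {d} {d'} d<d' d'<n = ≰⇒> λ wd≤wd' →
      <⇒≱ (s≤s d<d') (*-cancelʳ-≤ (suc d') (suc d) (weight d) {{weight≢0}} (chain wd≤wd'))
    where
      open ≤-Reasoning
      d<n : suc d ≤ n
      d<n = ≤-trans (s≤s (<⇒≤ d<d')) d'<n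
      weight≢0 : NonZero (weight d)
      weight≢0 = ≢-nonZero λ w≡0 → ≢-nonZero⁻¹ (n !) {{n !≢0}}
        (trans (sym (suc*weight≡! d<n)) (trans (cong (suc d *_) w≡0) (*-zeroʳ (suc d))))
      chain : weight d ≤ weight d' → suc d' * weight d ≤ suc d * weight d
      chain wd≤wd' = begin
        suc d' * weight d   ≤⟨ *-monoʳ-≤ (suc d') wd≤wd' ⟩
        suc d' * weight d'  ≡⟨ suc*weight≡! d'<n ⟩
        n !                 ≡⟨ suc*weight≡! d<n ⟨
        suc d * weight d    ∎

  sum-weight-cliqueDegrees : ∀ as → All (0 <_) as → sum as ≤ n →
                             sum (map weight (cliqueDegrees as)) ≡ length as * n !
  sum-weight-cliqueDegrees [] [] _ = refl
  sum-weight-cliqueDegrees (suc a ∷ as) (_ ∷ as>0) Σ≤n = begin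
    sum (map weight (replicate (suc a) a ++ cliqueDegrees as))
      ≡⟨ cong sum (map-++ weight (replicate (suc a) a) (cliqueDegrees as)) ⟩
    sum (map weight (replicate (suc a) a) ++ map weight (cliqueDegrees as))
      ≡⟨ sum-++ (map weight (replicate (suc a) a)) (map weight (cliqueDegrees as)) ⟩
    sum (map weight (replicate (suc a) a)) + sum (map weight (cliqueDegrees as))
      ≡⟨ cong₂ _+_ (trans (cong sum (map-replicate weight (suc a) a)) (sum-replicate (suc a) (weight a)))
                   (sum-weight-cliqueDegrees as as>0 (≤-trans (m≤n+m (sum as) (suc a)) Σ≤n)) ⟩
    suc a * weight a + length as * n !
      ≡⟨ cong (_+ length as * n !) (suc*weight≡! (≤-trans (m≤m+n (suc a) (sum as)) Σ≤n)) ⟩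
    length (suc a ∷ as) * n !
      ∎
    where open ≡-Reasoning

-- The greedy independent set

module InGraph {m : ℕ} (G : Graph m) where
  open WithDecEq (Fin._≟_ {m}) public
  open Weights m public

  degreeIn : List (Fin m) → Fin m → ℕ
  degreeIn R u = count (adj G u) R

  weightSum : List (Fin m) → ℕ
  weightSum R = sum (map (weight ∘ degreeIn R) R)

  IndependentList : List (Fin m) → Set
  IndependentList I = ∀ {u v} → u ∈ I → v ∈ I → adj G u v ≡ false

  ClusterOn : List (Fin m) → Set
  ClusterOn R = ∀ {u x z} → u ∈ R → x ∈ R → z ∈ R →
                adj G u x ≡ true → adj G x z ≡ true → u ≢ z → adj G u z ≡ true

  suc-degreeIn≤ : ∀ {R} u → Unique R → suc (degreeIn R u) ≤ m
  suc-degreeIn≤ {R} u uniq = subst (suc (degreeIn R u) ≤_) (length-vertices m)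
      (unique-⊆⇒length≤ (All.tabulate u≢ ∷ filter⁺ (T? ∘ adj G u) uniq) (λ {x} _ → ∈-vertices x))
    where
      u≢ : ∀ {x} → x ∈ filterᵇ (adj G u) R → u ≢ x
      u≢ x∈ refl = contradiction (trans (sym (proj₂ (∈-filterᵇ⁻ (adj G u) R x∈))) (irrefl G u)) λ ()

  module Neighbourhood (R : List (Fin m)) (v : Fin m) where

    inN[v] : Fin m → Bool
    inN[v] u = (u ≟ᵇ v) ∨ adj G v u

    N[v] : List (Fin m)
    N[v] = filterᵇ inN[v] R

    R∖N[v] : List (Fin m)
    R∖N[v] = filterᵇ (not ∘ inN[v]) R

    inN[v]⁻ : ∀ {u} → inN[v] u ≡ true → u ≡ v ⊎ adj G v u ≡ true
    inN[v]⁻ {u} inN with u Fin.≟ v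
    ... | yes u≡v = inj₁ u≡v
    ... | no _    = inj₂ inN

    inN[v]⁺ : ∀ {u} → u ≡ v ⊎ adj G v u ≡ true → inN[v] u ≡ true
    inN[v]⁺ (inj₁ refl) = cong (_∨ adj G v v) (≟ᵇ-refl v)
    inN[v]⁺ {u} (inj₂ vu) = trans (cong ((u ≟ᵇ v) ∨_) vu) (∨-zeroʳ (u ≟ᵇ v))

    ∈N[v]⁻ : ∀ {u} → u ∈ N[v] → u ∈ R × (u ≡ v ⊎ adj G v u ≡ true)
    ∈N[v]⁻ u∈ = let u∈R , inN = ∈-filterᵇ⁻ inN[v] R u∈ in u∈R , inN[v]⁻ inN

    ∈R∖N[v]⁻ : ∀ {u} → u ∈ R∖N[v] → u ∈ R × inN[v] u ≡ false
    ∈R∖N[v]⁻ u∈ = let u∈R , notN = ∈-filterᵇ⁻ (not ∘ inN[v]) R u∈ in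
      u∈R , not-injective {y = false} notN

    ∈R∖N[v]⇒≢ : ∀ {u} → u ∈ R∖N[v] → u ≢ v
    ∈R∖N[v]⇒≢ u∈ refl =
      contradiction (trans (sym (≟ᵇ-refl v)) (∨-conicalˡ _ _ (proj₂ (∈R∖N[v]⁻ u∈)))) λ ()

    ∈R∖N[v]⇒nonadj : ∀ {u} → u ∈ R∖N[v] → adj G v u ≡ false
    ∈R∖N[v]⇒nonadj u∈ = ∨-conicalʳ _ _ (proj₂ (∈R∖N[v]⁻ u∈))

    ∈N[v]⊎∈R∖N[v] : ∀ {u} → u ∈ R → u ∈ N[v] ⊎ u ∈ R∖N[v]
    ∈N[v]⊎∈R∖N[v] {u} u∈R with inN[v] u in inN
    ... | true  = inj₁ (∈-filterᵇ⁺ inN[v] u∈R inN)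
    ... | false = inj₂ (∈-filterᵇ⁺ (not ∘ inN[v]) u∈R (cong not inN))

    ∉N[v]∩R∖N[v] : ∀ {u} → u ∈ N[v] → u ∈ R∖N[v] → ⊥
    ∉N[v]∩R∖N[v] u∈N u∈R' =
      contradiction (trans (sym (proj₂ (∈-filterᵇ⁻ inN[v] R u∈N))) (proj₂ (∈R∖N[v]⁻ u∈R'))) λ ()

    N[v]-unique : Unique R → Unique N[v]
    N[v]-unique = filter⁺ (T? ∘ inN[v])

    R∖N[v]-unique : Unique R → Unique R∖N[v]
    R∖N[v]-unique = filter⁺ (T? ∘ not ∘ inN[v])

    length-N[v] : Unique R → v ∈ R → length N[v] ≡ suc (degreeIn R v)
    length-N[v] uniq v∈R = count-≟ᵇ-∨ R (irrefl G v) uniq v∈R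

    length-R∖N[v]< : v ∈ R → length R∖N[v] < length R
    length-R∖N[v]< v∈R = count<length R v∈R (cong not (inN[v]⁺ (inj₁ refl)))

    degreeIn-partition : ∀ u → degreeIn R u ≡ count (adj G u) N[v] + degreeIn R∖N[v] u
    degreeIn-partition u = count-partition (adj G u) inN[v] R

    suc-degreeIn≡count-N[v] : ∀ {y} → Unique R → y ∈ N[v] → (∀ {r} → r ∈ R∖N[v] → adj G y r ≡ false) →
                              suc (degreeIn R y) ≡ count (λ u → (u ≟ᵇ y) ∨ adj G y u) N[v]
    suc-degreeIn≡count-N[v] {y} uniq y∈ apart = begin
      suc (degreeIn R y)                              ≡⟨ cong suc (degreeIn-partition y) ⟩
      suc (count (adj G y) N[v] + degreeIn R∖N[v] y)  ≡⟨ cong (λ k → suc (count (adj G y) N[v] + k))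
                                                               (count-none R∖N[v] apart) ⟩
      suc (count (adj G y) N[v] + 0)                  ≡⟨ cong suc (+-identityʳ _) ⟩
      suc (count (adj G y) N[v])                      ≡⟨ count-≟ᵇ-∨ N[v] (irrefl G y) (N[v]-unique uniq) y∈ ⟨
      count (λ u → (u ≟ᵇ y) ∨ adj G y u) N[v]         ∎
      where open ≡-Reasoning

  record GreedyIndependentSet (R : List (Fin m)) : Set where
    field
      members     : List (Fin m)
      unique      : Unique members
      ⊆R          : ∀ {u} → u ∈ members → u ∈ R
      independent : IndependentList members
      caro-wei    : weightSum R ≤ m ! * length members
      tight⇒cluster : ClusterOn R ⊎ weightSum R < m ! * length members

  module GreedyStep (R : List (Fin m)) (v : Fin m) (uniq : Unique R) (v∈R : v ∈ R)
                    (v-min : ∀ {u} → u ∈ R → degreeIn R v ≤ degreeIn R u) where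
    open Neighbourhood R v

    sum-weight-N[v]≤ : sum (map (weight ∘ degreeIn R) N[v]) ≤ m !
    sum-weight-N[v]≤ = begin
      sum (map (weight ∘ degreeIn R) N[v])
        ≤⟨ sum-map-≤-* _ (weight d) N[v] (weight-antitone ∘ v-min ∘ proj₁ ∘ ∈N[v]⁻) ⟩
      length N[v] * weight d
        ≡⟨ cong (_* weight d) (length-N[v] uniq v∈R) ⟩
      suc d * weight d
        ≤⟨ suc*weight≤! d ⟩
      m !
        ∎
      where
        open ≤-Reasoning
        d = degreeIn R v

    weight-restrict : ∀ u → weight (degreeIn R u) ≤ weight (degreeIn R∖N[v] u)
    weight-restrict u = weight-antitone (count-filter≤ (adj G u) (not ∘ inN[v]) R)

    weightSum-partition : weightSum R ≡
      sum (map (weight ∘ degreeIn R) N[v]) + sum (map (weight ∘ degreeIn R) R∖N[v])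
    weightSum-partition = sum-map-partition (weight ∘ degreeIn R) inN[v] R

    weightSum-step : weightSum R ≤ m ! + weightSum R∖N[v]
    weightSum-step = ≤-trans (≤-reflexive weightSum-partition)
      (+-mono-≤ sum-weight-N[v]≤ (sum-map-mono-≤ R∖N[v] weight-restrict))

    weightSum-step-< : ∀ {y} → y ∈ R∖N[v] → degreeIn R∖N[v] y < degreeIn R y →
                       weightSum R < m ! + weightSum R∖N[v]
    weightSum-step-< y∈ lost = ≤-<-trans (≤-reflexive weightSum-partition)
      (+-mono-≤-< sum-weight-N[v]≤
        (sum-map-mono-< R∖N[v] weight-restrict y∈ (weight-strict lost (suc-degreeIn≤ _ uniq))))

    independent-∷ : ∀ {I} → (∀ {u} → u ∈ I → u ∈ R∖N[v]) → IndependentList I →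
                    IndependentList (v ∷ I)
    independent-∷ I⊆ indep (here refl) (here refl) = irrefl G v
    independent-∷ I⊆ indep (here refl) (there y∈) = ∈R∖N[v]⇒nonadj (I⊆ y∈)
    independent-∷ I⊆ indep (there x∈) (here refl) = trans (adj-sym G _ v) (∈R∖N[v]⇒nonadj (I⊆ x∈))
    independent-∷ I⊆ indep (there x∈) (there y∈) = indep x∈ y∈

    unique-∷ : ∀ {I} → (∀ {u} → u ∈ I → u ∈ R∖N[v]) → Unique I → Unique (v ∷ I)
    unique-∷ I⊆ uI = All.tabulate (λ u∈ v≡u → ∈R∖N[v]⇒≢ (I⊆ u∈) (sym v≡u)) ∷ uI

    -- The equality case: if deleting N[v] lowers no degree in R∖N[v], no edge leaves N[v], and
    -- then the minimality of deg v forces N[v] to be a clique.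
    module _ (no-loss : ∀ {y} → y ∈ R∖N[v] → degreeIn R y ≤ degreeIn R∖N[v] y) where

      R∖N[v]-N[v]-nonadj : ∀ {y z} → y ∈ R∖N[v] → z ∈ N[v] → adj G y z ≡ false
      R∖N[v]-N[v]-nonadj {y} y∈ z∈ =
        count≡0⇒false N[v] (n≤0⇒n≡0 (+-cancelʳ-≤ (degreeIn R∖N[v] y) _ 0 no-edge-in)) z∈
        where
          no-edge-in : count (adj G y) N[v] + degreeIn R∖N[v] y ≤ 0 + degreeIn R∖N[v] y
          no-edge-in = ≤-trans (≤-reflexive (sym (degreeIn-partition y))) (no-loss y∈)

      N[v]-clique : ∀ {y z} → y ∈ N[v] → z ∈ N[v] → y ≢ z → adj G y z ≡ true
      N[v]-clique {y} {z} y∈ z∈ y≢z =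
          trans (cong (_∨ adj G y z) (sym (≟ᵇ-≢ (y≢z ∘ sym)))) (count≥length⇒true N[v] full z∈)
        where
          open ≤-Reasoning
          no-edge-out : ∀ {r} → r ∈ R∖N[v] → adj G y r ≡ false
          no-edge-out r∈ = trans (adj-sym G _ _) (R∖N[v]-N[v]-nonadj r∈ y∈)
          full : length N[v] ≤ count (λ u → (u ≟ᵇ y) ∨ adj G y u) N[v]
          full = begin
            length N[v]                              ≡⟨ length-N[v] uniq v∈R ⟩
            suc (degreeIn R v)                       ≤⟨ s≤s (v-min (proj₁ (∈N[v]⁻ y∈))) ⟩
            suc (degreeIn R y)                       ≡⟨ suc-degreeIn≡count-N[v] uniq y∈ no-edge-out ⟩
            count (λ u → (u ≟ᵇ y) ∨ adj G y u) N[v]  ∎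

      same-side : ∀ {x u} → x ∈ R → u ∈ R → adj G x u ≡ true →
                  (x ∈ N[v] × u ∈ N[v]) ⊎ (x ∈ R∖N[v] × u ∈ R∖N[v])
      same-side x∈ u∈ xu with ∈N[v]⊎∈R∖N[v] x∈ | ∈N[v]⊎∈R∖N[v] u∈
      ... | inj₁ x∈N  | inj₁ u∈N  = inj₁ (x∈N , u∈N)
      ... | inj₂ x∈R' | inj₂ u∈R' = inj₂ (x∈R' , u∈R')
      ... | inj₂ x∈R' | inj₁ u∈N  = contradiction (trans (sym xu) (R∖N[v]-N[v]-nonadj x∈R' u∈N)) λ ()
      ... | inj₁ x∈N  | inj₂ u∈R' =
        contradiction (trans (sym xu) (trans (adj-sym G _ _) (R∖N[v]-N[v]-nonadj u∈R' x∈N))) λ ()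

      cluster-step : ClusterOn R∖N[v] → ClusterOn R
      cluster-step cluster' u∈ x∈ z∈ ux xz u≢z
        with same-side x∈ u∈ (trans (adj-sym G _ _) ux) | same-side x∈ z∈ xz
      ... | inj₁ (_ , u∈N)       | inj₁ (_ , z∈N)    = N[v]-clique u∈N z∈N u≢z
      ... | inj₂ (x∈R' , u∈R')   | inj₂ (_ , z∈R')   = cluster' u∈R' x∈R' z∈R' ux xz u≢z
      ... | inj₁ (x∈N , _)       | inj₂ (x∈R' , _)   = ⊥-elim (∉N[v]∩R∖N[v] x∈N x∈R')
      ... | inj₂ (x∈R' , _)      | inj₁ (x∈N , _)    = ⊥-elim (∉N[v]∩R∖N[v] x∈N x∈R')


    step-bound : ∀ {k} → weightSum R∖N[v] ≤ m ! * k → m ! + weightSum R∖N[v] ≤ m ! * suc k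
    step-bound {k} bound = ≤-trans (+-monoʳ-≤ (m !) bound) (≤-reflexive (sym (*-suc (m !) k)))

    tight⇒cluster-step : ∀ {k} → weightSum R∖N[v] ≤ m ! * k →
      ClusterOn R∖N[v] ⊎ weightSum R∖N[v] < m ! * k → ClusterOn R ⊎ weightSum R < m ! * suc k
    tight⇒cluster-step {k} _ (inj₂ strict) =
      inj₂ (≤-<-trans weightSum-step
              (<-≤-trans (+-monoʳ-< (m !) strict) (≤-reflexive (sym (*-suc (m !) k)))))
    tight⇒cluster-step bound (inj₁ cluster') with any? (λ y → degreeIn R∖N[v] y <? degreeIn R y) R∖N[v]
    ... | yes lost = let _ , y∈ , lt = find lost in
                     inj₂ (<-≤-trans (weightSum-step-< y∈ lt) (step-bound bound))
    ... | no ¬lost = inj₁ (cluster-step (λ y∈ → ≮⇒≥ (¬lost ∘ lose y∈)) cluster')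

    extend : GreedyIndependentSet R∖N[v] → GreedyIndependentSet R
    extend I = record
      { members       = v ∷ members
      ; unique        = unique-∷ ⊆R unique
      ; ⊆R            = λ { (here refl) → v∈R ; (there u∈) → proj₁ (∈R∖N[v]⁻ (⊆R u∈)) }
      ; independent   = independent-∷ ⊆R independent
      ; caro-wei      = ≤-trans weightSum-step (step-bound caro-wei)
      ; tight⇒cluster = tight⇒cluster-step caro-wei tight⇒cluster
      }
      where open GreedyIndependentSet I

  greedy : ∀ n R → length R ≤ n → Unique R → GreedyIndependentSet R
  greedy _ [] _ _ = record
    { members = [] ; unique = [] ; ⊆R = λ () ; independent = λ ()
    ; caro-wei = z≤n ; tight⇒cluster = inj₁ λ () }
  greedy (suc n) R@(r ∷ _) |R|≤ uniq =
    extend (greedy n R∖N[v] (≤-pred (≤-trans (length-R∖N[v]< v∈R) |R|≤)) (R∖N[v]-unique uniq))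
    where
      v = argmin (degreeIn R) r R
      v∈R : v ∈ R
      v∈R = [ (λ v≡r → subst (_∈ R) (sym v≡r) (here refl)) , (λ v∈ → v∈) ]′
              (argmin-sel (degreeIn R) r R)
      open Neighbourhood R v
      open GreedyStep R v uniq v∈R (All.lookup (f[argmin]≤f[xs] {f = degreeIn R} r R))

-- Cluster graphs with the degrees of a union of cliques

module _ {X : Set} where

  prepend : ∀ {n} (C : List X) → (Fin n → X) → Fin (length C + n) → X
  prepend []      φ i       = φ i
  prepend (c ∷ C) φ zero    = c
  prepend (c ∷ C) φ (suc i) = prepend C φ i

  prepend-cases : ∀ {n} C (φ : Fin n → X) i → prepend C φ i ∈ C ⊎ ∃[ j ] prepend C φ i ≡ φ j
  prepend-cases []      φ i       = inj₂ (i , refl)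
  prepend-cases (c ∷ C) φ zero    = inj₁ (here refl)
  prepend-cases (c ∷ C) φ (suc i) with prepend-cases C φ i
  ... | inj₁ x∈C = inj₁ (there x∈C)
  ... | inj₂ j,≡ = inj₂ j,≡

  prepend-block-cases : ∀ as C (φ : Fin (sum as) → X) i →
    (block (length C ∷ as) i ≡ 0 × prepend C φ i ∈ C) ⊎
    (∃[ j ] block (length C ∷ as) i ≡ suc (block as j) × prepend C φ i ≡ φ j)
  prepend-block-cases as []      φ i       = inj₂ (i , refl , refl)
  prepend-block-cases as (c ∷ C) φ zero    = inj₁ (refl , here refl)
  prepend-block-cases as (c ∷ C) φ (suc i) with prepend-block-cases as C φ i
  ... | inj₁ (b≡0 , x∈C) = inj₁ (b≡0 , there x∈C)
  ... | inj₂ j,≡         = inj₂ j,≡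

  prepend-injective : ∀ {n} C (φ : Fin n → X) → Unique C → (∀ {i j} → φ i ≡ φ j → i ≡ j) →
                      (∀ j → φ j ∉ C) → ∀ {i j} → prepend C φ i ≡ prepend C φ j → i ≡ j
  prepend-injective []      φ _ φ-inj _ eq = φ-inj eq
  prepend-injective (c ∷ C) φ _ _ _ {zero} {zero} _ = refl
  prepend-injective (c ∷ C) φ (c∉ ∷ _) _ φ∉ {zero} {suc j} eq with prepend-cases C φ j
  ... | inj₁ x∈C         = contradiction eq (All.lookup c∉ x∈C)
  ... | inj₂ (j' , x≡φj') = contradiction (here (sym (trans eq x≡φj'))) (φ∉ j')
  prepend-injective (c ∷ C) φ (c∉ ∷ _) _ φ∉ {suc i} {zero} eq with prepend-cases C φ i
  ... | inj₁ x∈C         = contradiction (sym eq) (All.lookup c∉ x∈C)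
  ... | inj₂ (i' , x≡φi') = contradiction (here (trans (sym x≡φi') eq)) (φ∉ i')
  prepend-injective (c ∷ C) φ (_ ∷ uC) φ-inj φ∉ {suc i} {suc j} eq =
    cong suc (prepend-injective C φ uC φ-inj (λ j → φ∉ j ∘ there) eq)

  prepend-onto : ∀ {n} C (φ : Fin n → X) {u} → u ∈ C ⊎ ∃[ j ] φ j ≡ u → ∃[ i ] prepend C φ i ≡ u
  prepend-onto []      φ (inj₂ j,≡)           = j,≡
  prepend-onto (c ∷ C) φ (inj₁ (here refl))   = zero , refl
  prepend-onto (c ∷ C) φ (inj₁ (there u∈C))   = let i , eq = prepend-onto C φ (inj₁ u∈C) in suc i , eq
  prepend-onto (c ∷ C) φ (inj₂ j,≡)           = let i , eq = prepend-onto C φ (inj₂ j,≡) in suc i , eq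

isYes-suc : ∀ {n} (i j : Fin n) → ⌊ suc i Fin.≟ suc j ⌋ ≡ ⌊ i Fin.≟ j ⌋
isYes-suc i j with i Fin.≟ j
... | yes _ = refl
... | no _  = refl

module _ {m : ℕ} (G : Graph m) where
  open InGraph G

  module _ (as : List ℕ) (c : Fin m) (C : List (Fin m)) (φ : Fin (sum as) → Fin m) (c∉C : All (c ≢_) C)
           (clique : ∀ {x y} → x ∈ c ∷ C → y ∈ c ∷ C → x ≢ y → adj G x y ≡ true)
           (apart : ∀ {x} j → x ∈ c ∷ C → adj G x (φ j) ≡ false) where

    prepend-adj-head : ∀ j → adj G c (prepend C φ j) ≡ unionAdj (length (c ∷ C) ∷ as) zero (suc j)
    prepend-adj-head j with prepend-block-cases as C φ j
    ... | inj₁ (b≡0 , x∈C)      rewrite b≡0       = clique (here refl) (there x∈C) (All.lookup c∉C x∈C)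
    ... | inj₂ (j' , b≡ , x≡φj') rewrite b≡ | x≡φj' = apart j' (here refl)

  prepend-adj : ∀ as C (φ : Fin (sum as) → Fin m) → Unique C →
    (∀ {x y} → x ∈ C → y ∈ C → x ≢ y → adj G x y ≡ true) →
    (∀ {x} j → x ∈ C → adj G x (φ j) ≡ false) →
    (∀ i j → adj G (φ i) (φ j) ≡ unionAdj as i j) →
    ∀ i j → adj G (prepend C φ i) (prepend C φ j) ≡ unionAdj (length C ∷ as) i j
  prepend-adj as []      φ _ _ _ adj-φ i j = adj-φ i j
  prepend-adj as (c ∷ C) φ _ _ _ _ zero zero = irrefl G c
  prepend-adj as (c ∷ C) φ (c∉C ∷ _) clique apart _ zero (suc j) =
    prepend-adj-head as c C φ c∉C clique apart j
  prepend-adj as (c ∷ C) φ (c∉C ∷ _) clique apart _ (suc i) zero =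
    trans (adj-sym G _ _) (trans (prepend-adj-head as c C φ c∉C clique apart i)
                                 (adj-sym (⋃K (length (c ∷ C) ∷ as)) zero (suc i)))
  prepend-adj as (c ∷ C) φ (_ ∷ uC) clique apart adj-φ (suc i) (suc j) =
    trans (prepend-adj as C φ uC (λ x∈ y∈ → clique (there x∈) (there y∈)) (λ j → apart j ∘ there)
                       adj-φ i j)
          (cong (λ b → (block (length C ∷ as) i ≡ᵇ block (length C ∷ as) j) ∧ not b) (sym (isYes-suc i j)))

  record Embedding (as : List ℕ) (R : List (Fin m)) : Set where
    field
      φ         : Fin (sum as) → Fin m
      injective : ∀ {i j} → φ i ≡ φ j → i ≡ j
      φ∈R       : ∀ i → φ i ∈ R
      onto      : ∀ {u} → u ∈ R → ∃[ i ] φ i ≡ u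
      adj-φ     : ∀ i j → adj G (φ i) (φ j) ≡ unionAdj as i j

  Closed : List (Fin m) → Set
  Closed R = ∀ {u y} → u ∈ R → adj G u y ≡ true → y ∈ R

  DegreeCounts : List ℕ → List (Fin m) → Set
  DegreeCounts as R = ∀ d → count (λ u → degree G u ≡ᵇ d) R ≡ count (_≡ᵇ d) (cliqueDegrees as)

  degreeCounts-[]⇒∉ : ∀ {R u} → DegreeCounts [] R → u ∉ R
  degreeCounts-[]⇒∉ {R} {u} counts u∈ =
    contradiction (trans (sym (≡ᵇ-refl (degree G u))) (count≡0⇒false R (counts (degree G u)) u∈)) λ ()

  vertex-of-degree : ∀ {a as R} → DegreeCounts (suc a ∷ as) R → ∃[ v ] v ∈ R × degree G v ≡ a
  vertex-of-degree {a} {as} {R} counts =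
    let v , v∈R , deg≡ᵇa = count>0⇒∃ (λ u → degree G u ≡ᵇ a) R
                                      (subst (0 <_) (sym (counts a)) a∈degrees)
    in v , v∈R , ≡ᵇ⇒≡ _ _ (Equivalence.from T-≡ deg≡ᵇa)
    where
      a∈degrees : 0 < count (_≡ᵇ a) (cliqueDegrees (suc a ∷ as))
      a∈degrees = ∈⇒count>0 {p = _≡ᵇ a} (cliqueDegrees (suc a ∷ as)) (here refl) (≡ᵇ-refl a)

  degreeIn-closed : ∀ {R u} → Unique R → Closed R → u ∈ R → degreeIn R u ≡ degree G u
  degreeIn-closed {R} {u} uniq closed u∈ = trans
    (≤-antisym (count-⊆ (adj G u) uniq (λ {x} _ _ → ∈-vertices x))
               (count-⊆ (adj G u) (vertices-unique m) (λ _ ux → closed u∈ ux)))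
    (sym (degree≡count G u))

  module Transitive (transitive : ∀ {u x z} → adj G u x ≡ true → adj G x z ≡ true → u ≢ z →
                                  adj G u z ≡ true) where

    module BuildStep (R : List (Fin m)) (v : Fin m) (uniq : Unique R) (closed : Closed R) (v∈R : v ∈ R) where
      open Neighbourhood R v

      N[v]-clique : ∀ {y z} → y ∈ N[v] → z ∈ N[v] → y ≢ z → adj G y z ≡ true
      N[v]-clique y∈ z∈ y≢z with proj₂ (∈N[v]⁻ y∈) | proj₂ (∈N[v]⁻ z∈)
      ... | inj₁ refl | inj₁ refl = contradiction refl y≢z
      ... | inj₁ refl | inj₂ vz   = vz
      ... | inj₂ vy   | inj₁ refl = trans (adj-sym G _ _) vy
      ... | inj₂ vy   | inj₂ vz   = transitive (trans (adj-sym G _ _) vy) vz y≢z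

      N[v]-R∖N[v]-nonadj : ∀ {y r} → y ∈ N[v] → r ∈ R∖N[v] → adj G y r ≡ false
      N[v]-R∖N[v]-nonadj {y} {r} y∈ r∈ with adj G y r in yr
      ... | false = refl
      ... | true  = contradiction (trans (sym (inN[v]⁺ r≡v⊎v~r)) (proj₂ (∈R∖N[v]⁻ r∈))) λ ()
        where
          r≡v⊎v~r : r ≡ v ⊎ adj G v r ≡ true
          r≡v⊎v~r with proj₂ (∈N[v]⁻ y∈) | r Fin.≟ v
          ... | inj₁ refl | _       = inj₂ yr
          ... | inj₂ _    | yes r≡v = inj₁ r≡v
          ... | inj₂ vy   | no r≢v  = inj₂ (transitive vy yr (r≢v ∘ sym))

      R∖N[v]-closed : Closed R∖N[v]
      R∖N[v]-closed {u} {y} u∈ uy with ∈N[v]⊎∈R∖N[v] (closed (proj₁ (∈R∖N[v]⁻ u∈)) uy)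
      ... | inj₂ y∈ = y∈
      ... | inj₁ y∈ =
        contradiction (trans (sym uy) (trans (adj-sym G u y) (N[v]-R∖N[v]-nonadj y∈ u∈))) λ ()

      suc-degree-N[v] : ∀ {y} → y ∈ N[v] → suc (degree G y) ≡ length N[v]
      suc-degree-N[v] {y} y∈ = begin
        suc (degree G y)                         ≡⟨ cong suc (degreeIn-closed uniq closed (proj₁ (∈N[v]⁻ y∈))) ⟨
        suc (degreeIn R y)                       ≡⟨ suc-degreeIn≡count-N[v] uniq y∈ (N[v]-R∖N[v]-nonadj y∈) ⟩
        count (λ u → (u ≟ᵇ y) ∨ adj G y u) N[v]  ≡⟨ count-all N[v] closed-nbr ⟩
        length N[v]                              ∎
        where
          open ≡-Reasoning
          closed-nbr : ∀ {z} → z ∈ N[v] → ((z ≟ᵇ y) ∨ adj G y z) ≡ true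
          closed-nbr {z} z∈ with z Fin.≟ y
          ... | yes _  = refl
          ... | no z≢y = N[v]-clique y∈ z∈ (z≢y ∘ sym)

      length-N[v]≡suc-degree : length N[v] ≡ suc (degree G v)
      length-N[v]≡suc-degree = sym (suc-degree-N[v] (∈-filterᵇ⁺ inN[v] v∈R (inN[v]⁺ (inj₁ refl))))

      degreeCounts-R∖N[v] : ∀ {a as} → degree G v ≡ a → DegreeCounts (suc a ∷ as) R →
                            DegreeCounts as R∖N[v]
      degreeCounts-R∖N[v] {a} {as} deg-v counts d =
        +-cancelˡ-≡ (count (_≡ᵇ d) (replicate (suc a) a)) _ _ (begin
          count (_≡ᵇ d) (replicate (suc a) a) + count deg≡d R∖N[v]   ≡⟨ cong (_+ count deg≡d R∖N[v]) N[v]-count ⟨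
          count deg≡d N[v] + count deg≡d R∖N[v]                      ≡⟨ count-partition deg≡d inN[v] R ⟨
          count deg≡d R                                              ≡⟨ counts d ⟩
          count (_≡ᵇ d) (replicate (suc a) a ++ cliqueDegrees as)    ≡⟨ count-++ (_≡ᵇ d) (replicate (suc a) a) _ ⟩
          count (_≡ᵇ d) (replicate (suc a) a) + count (_≡ᵇ d) (cliqueDegrees as) ∎)
        where
          open ≡-Reasoning
          deg≡d : Fin m → Bool
          deg≡d u = degree G u ≡ᵇ d
          |N[v]| : length N[v] ≡ suc a
          |N[v]| = trans length-N[v]≡suc-degree (cong suc deg-v)
          degree≡a : ∀ {y} → y ∈ N[v] → degree G y ≡ a
          degree≡a y∈ = suc-injective (trans (suc-degree-N[v] y∈) |N[v]|)
          N[v]-count : count deg≡d N[v] ≡ count (_≡ᵇ d) (replicate (suc a) a)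
          N[v]-count = begin
            count deg≡d N[v]                     ≡⟨ count-cong N[v] (cong (_≡ᵇ d) ∘ degree≡a) ⟩
            count (λ _ → a ≡ᵇ d) N[v]            ≡⟨ count-const (a ≡ᵇ d) N[v] ⟩
            (if a ≡ᵇ d then length N[v] else 0)  ≡⟨ cong (λ n → if a ≡ᵇ d then n else 0) |N[v]| ⟩
            (if a ≡ᵇ d then suc a else 0)        ≡⟨ count-replicate (_≡ᵇ d) (suc a) a ⟨
            count (_≡ᵇ d) (replicate (suc a) a)  ∎

      extend : ∀ {as} → Embedding as R∖N[v] → Embedding (length N[v] ∷ as) R
      extend {as} e = record
        { φ         = prepend N[v] φ
        ; injective = prepend-injective N[v] φ (N[v]-unique uniq) injective
                        (λ j φj∈ → ∉N[v]∩R∖N[v] φj∈ (φ∈R j))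
        ; φ∈R       = λ i → [ proj₁ ∘ ∈N[v]⁻
                            , (λ (j , eq) → subst (_∈ R) (sym eq) (proj₁ (∈R∖N[v]⁻ (φ∈R j)))) ]′
                            (prepend-cases N[v] φ i)
        ; onto      = λ u∈ → prepend-onto N[v] φ ([ inj₁ , inj₂ ∘ onto ]′ (∈N[v]⊎∈R∖N[v] u∈))
        ; adj-φ     = prepend-adj as N[v] φ (N[v]-unique uniq) N[v]-clique
                        (λ j x∈ → N[v]-R∖N[v]-nonadj x∈ (φ∈R j)) adj-φ
        }
        where open Embedding e

    embed : ∀ as R → All (0 <_) as → Unique R → Closed R → DegreeCounts as R → Embedding as R
    embed [] R _ _ _ counts = record
      { φ = λ () ; injective = λ { {()} } ; φ∈R = λ () ; adj-φ = λ ()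
      ; onto = λ u∈ → ⊥-elim (degreeCounts-[]⇒∉ counts u∈) }
    embed (suc a ∷ as) R (_ ∷ as>0) uniq closed counts with vertex-of-degree {as = as} counts
    ... | v , v∈R , deg-v =
          subst (λ b → Embedding (b ∷ as) R) (trans length-N[v]≡suc-degree (cong suc deg-v))
            (extend (embed as R∖N[v] as>0 (R∖N[v]-unique uniq) R∖N[v]-closed
                       (degreeCounts-R∖N[v] {as = as} deg-v counts)))
      where
        open Neighbourhood R v
        open BuildStep R v uniq closed v∈R

  embedding⇒isomorphic : ∀ {as} → Embedding as (vertices m) → Isomorphic G (⋃K as)
  embedding⇒isomorphic {as} e = mk⤖ {to = φ⁻¹} (φ⁻¹-injective , φ⁻¹-surjective) , preserves
    where
      open Embedding e
      φ⁻¹ : Fin m → Fin (sum as)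
      φ⁻¹ u = proj₁ (onto (∈-vertices u))
      φ∘φ⁻¹ : ∀ u → φ (φ⁻¹ u) ≡ u
      φ∘φ⁻¹ u = proj₂ (onto (∈-vertices u))
      φ⁻¹-injective : ∀ {u v} → φ⁻¹ u ≡ φ⁻¹ v → u ≡ v
      φ⁻¹-injective {u} {v} eq = trans (sym (φ∘φ⁻¹ u)) (trans (cong φ eq) (φ∘φ⁻¹ v))
      φ⁻¹-surjective : ∀ i → ∃[ u ] ∀ {v} → v ≡ u → φ⁻¹ v ≡ i
      φ⁻¹-surjective i = φ i , λ { refl → injective (φ∘φ⁻¹ (φ i)) }
      preserves : ∀ u v → unionAdj as (φ⁻¹ u) (φ⁻¹ v) ≡ adj G u v
      preserves u v = trans (sym (adj-φ (φ⁻¹ u) (φ⁻¹ v))) (cong₂ (adj G) (φ∘φ⁻¹ u) (φ∘φ⁻¹ v))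

  isomorphic⇒independent≤ : ∀ {as} → Isomorphic G (⋃K as) →
                            ∀ S → Independent G S → ∣ S ∣ ≤ length as
  isomorphic⇒independent≤ {as} (f , preserves) S indep = begin
    ∣ S ∣                          ≡⟨ length-elements S ⟨
    length (elements S)            ≡⟨ length-map to (elements S) ⟨
    length (map to (elements S))   ≤⟨ independent-⋃K-length≤ as unique indep′ ⟩
    length as                      ∎
    where
      open ≤-Reasoning
      to = Bijection.to f
      unique : Unique (map to (elements S))
      unique = map-unique to (elements-unique S) (λ _ _ → Bijection.injective f)
      indep′ : ∀ {i j} → i ∈ map to (elements S) → j ∈ map to (elements S) → unionAdj as i j ≡ false
      indep′ i∈ j∈ with ∈-map⁻ to i∈ | ∈-map⁻ to j∈
      ... | u , u∈ , refl | v , v∈ , refl =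
        trans (preserves u v) (indep u v (∈elements⁻ S u∈) (∈elements⁻ S v∈))

module _ (as : List ℕ) (as>0 : All (0 <_) as) {m : ℕ} (G : Graph m) (deq : DegreeEquivalent G (⋃K as)) where
  open InGraph G

  private
    V : List (Fin m)
    V = vertices m

  m≡sum : m ≡ sum as
  m≡sum = begin
    m                           ≡⟨ length-degreeList G ⟨
    length (degreeList G)       ≡⟨ ↭-length deq ⟩
    length (degreeList (⋃K as)) ≡⟨ length-degreeList (⋃K as) ⟩
    sum as                      ∎
    where open ≡-Reasoning

  weightSum-vertices : weightSum V ≡ m ! * length as
  weightSum-vertices = begin
    sum (map (weight ∘ degreeIn V) V)
      ≡⟨ cong sum (map-cong (λ u → cong weight (degree≡count G u)) V) ⟨
    sum (map (weight ∘ degree G) V)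
      ≡⟨ cong sum (map-∘ V) ⟩
    sum (map weight (degreeList G))
      ≡⟨ sum-↭ (↭-map⁺ weight deq) ⟩
    sum (map weight (degreeList (⋃K as)))
      ≡⟨ cong (sum ∘ map weight) (degreeList-⋃K as) ⟩
    sum (map weight (cliqueDegrees as))
      ≡⟨ sum-weight-cliqueDegrees as as>0 (≤-reflexive (sym m≡sum)) ⟩
    length as * m !
      ≡⟨ *-comm (length as) (m !) ⟩
    m ! * length as
      ∎
    where open ≡-Reasoning

  module Greedy = GreedyIndependentSet (greedy (length V) V ≤-refl (vertices-unique m))

  length-as≤ : length as ≤ length Greedy.members
  length-as≤ = *-cancelˡ-≤ (m !) {{m !≢0}}
    (subst (_≤ m ! * length Greedy.members) weightSum-vertices Greedy.caro-wei)

  independent-fromList : ∀ {J} → (∀ {u} → u ∈ J → u ∈ Greedy.members) → Independent G (fromList J)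
  independent-fromList J⊆ u v u∈ v∈ =
    Greedy.independent (J⊆ (∈fromList⁻ _ u∈)) (J⊆ (∈fromList⁻ _ v∈))

  independence≥ : Σ (Subset m) (λ S → Independent G S × ∣ S ∣ ≡ length as)
  independence≥ = fromList J , independent-fromList (∈-take⁻ (length as) Greedy.members) , ∣J∣≡
    where
      J : List (Fin m)
      J = take (length as) Greedy.members
      ∣J∣≡ : ∣ fromList J ∣ ≡ length as
      ∣J∣≡ = begin
        ∣ fromList J ∣                         ≡⟨ ∣fromList∣ (take⁺ (length as) Greedy.unique) ⟩
        length J                               ≡⟨ length-take (length as) Greedy.members ⟩
        length as ⊓ length Greedy.members      ≡⟨ m≤n⇒m⊓n≡m length-as≤ ⟩
        length as                              ∎
        where open ≡-Reasoning

  independence≤⇒cluster : (∀ S → Independent G S → ∣ S ∣ ≤ length as) → ClusterOn V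
  independence≤⇒cluster α≤ with Greedy.tight⇒cluster
  ... | inj₁ cluster = cluster
  ... | inj₂ strict  = contradiction (α≤ (fromList Greedy.members) (independent-fromList (λ u∈ → u∈))) (<⇒≱ k<α)
    where
      k<α : length as < ∣ fromList Greedy.members ∣
      k<α = subst (length as <_) (sym (∣fromList∣ Greedy.unique))
        (*-cancelˡ-< (m !) (length as) (length Greedy.members)
          (subst (_< m ! * length Greedy.members) weightSum-vertices strict))

  cluster⇒isomorphic : ClusterOn V → Isomorphic G (⋃K as)
  cluster⇒isomorphic cluster = embedding⇒isomorphic G
    (Transitive.embed G transitive as V as>0 (vertices-unique m) (λ {_} {y} _ _ → ∈-vertices y) counts)
    where
      transitive : ∀ {u x z} → adj G u x ≡ true → adj G x z ≡ true → u ≢ z → adj G u z ≡ true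
      transitive = cluster (∈-vertices _) (∈-vertices _) (∈-vertices _)
      counts : DegreeCounts G as V
      counts d = begin
        count (λ u → degree G u ≡ᵇ d) V            ≡⟨ count-map (_≡ᵇ d) (degree G) V ⟨
        count (_≡ᵇ d) (degreeList G)                ≡⟨ count-↭ (_≡ᵇ d) deq ⟩
        count (_≡ᵇ d) (degreeList (⋃K as))          ≡⟨ cong (count (_≡ᵇ d)) (degreeList-⋃K as) ⟩
        count (_≡ᵇ d) (cliqueDegrees as)            ∎
        where open ≡-Reasoning

corollary2 : (k : ℕ) → 1 ≤ k → (as : List ℕ) → length as ≡ k → All (λ a → 0 < a) as →
    {m : ℕ} (G : Graph m) → DegreeEquivalent G (⋃K as) →
    (IndependenceNumber G k ⇔ Isomorphic G (⋃K as))
corollary2 .(length as) _ as refl as>0 G deq = mk⇔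
  (λ (_ , α≤k) → cluster⇒isomorphic as as>0 G deq (independence≤⇒cluster as as>0 G deq α≤k))
  (λ iso → independence≥ as as>0 G deq , isomorphic⇒independent≤ G {as} iso)
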